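{- Let $U, V$ be finite sets of integers with $U$ nonempty. For an integer $n$ put \[ \sigma(n) = \#\{(u,v) : u \in U, v \in V, u+v = n\}, \qquad \delta(n) = \#\{(u,v) : u\in U, v \in V, v-u = n\}. \] Then \[ \sum_{n:\ \sigma(n) > 1} (\sigma(n) - 1) \ \ge\ \frac{1}{|U|} \sum_{n:\ \delta(n) > 1} (\delta(n) - 1). \] -}

module Defs where

open import Data.Nat using (ℕ; _∸_; _<?_)
open import Data.Integer using (ℤ; _+_; _-_)
import Data.Integer.Properties as ℤP
open import Data.List using (List; length; filter; map; cartesianProductWith; deduplicate)
open import Data.Nat.ListAction using (sum)
open import Relation.Binary.PropositionalEquality using (_≡_)
open import Relation.Nullary.Decidable using (does)

count : ℤ → List ℤ → ℕ
count n xs = length (filter (λ x → x ℤP.≟ n) xs)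

sums : List ℤ → List ℤ → List ℤ
sums U V = cartesianProductWith (λ u v → u + v) U V

diffs : List ℤ → List ℤ → List ℤ
diffs U V = cartesianProductWith (λ u v → v - u) U V

σ : List ℤ → List ℤ → ℤ → ℕ
σ U V n = count n (sums U V)

δ : List ℤ → List ℤ → ℤ → ℕ
δ U V n = count n (diffs U V)

-- Σ_{n : f n > 1} (f n - 1), where n ranges over the distinct elements of
-- `support` (every n with f n > 0 must occur in support).
excessSum : List ℤ → (ℤ → ℕ) → ℕ
excessSum support f =
  sum (map (λ n → f n ∸ 1) (filter (λ n → 1 <? f n) (deduplicate ℤP._≟_ support)))

module Submission where

-- Let repeats L count the positions of a list L whose value recurs further right;
-- then excessSum for σ (resp. δ) is repeats (sums U V) (resp. repeats (diffs U V)),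
-- and we show repeats (diffs U V) ≤ |U| · repeats (sums U V) by induction on U.  Peeling off u ∈ U splits
-- diffs into (V - u) ++ diffs U' V and sums into (u + V) ++ sums U' V.  With
-- hits A B = #{(a, b) ∈ A × B : a = b} and meets A B = #{a ∈ A : a occurs in B},
--   meets A B + repeats B ≤ repeats (A ++ B) ≤ repeats A + hits A B + repeats B.
-- V - u has no repeats, and as w - u' = v - u ⇔ u' + v = u + w,
-- hits (V - u) (V - u') = hits (u + V) (u' + V) = meets (u + V) (u' + V), so
-- hits (V - u) (diffs U' V) ≤ |U'| · meets (u + V) (sums U' V), closing the induction.

open import Defs
open import Data.Nat using (_*_; _≤_)
open import Data.Integer using (ℤ)
open import Data.List using (List; _∷_; length)
open import Data.List.Relation.Unary.Unique.Propositional using (Unique)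

open import Level using (Level)
open import Function using (_∘_)
open import Data.Nat using (ℕ; zero; suc; _+_; _∸_; _⊓_; _<?_; z≤n; s≤s)
open import Data.Nat.Properties
import Data.Nat.Tactic.RingSolver as ℕ-Solver
import Data.Integer as ℤ
import Data.Integer.Properties as ℤP
import Data.Integer.Tactic.RingSolver as ℤ-Solver
open import Data.List using ([]; _++_; map; filter; deduplicate)
open import Data.List.Properties using (map-∘; length-++; filter-++; filter-accept; filter-reject)
open import Data.Nat.ListAction using (sum)
open import Data.List.Relation.Unary.All using (All; []; _∷_)
open import Data.List.Relation.Unary.AllPairs using ([]; _∷_)
import Data.List.Relation.Unary.Unique.Propositional.Properties as Unique
open import Relation.Binary.Definitions using (DecidableEquality)
open import Relation.Binary.PropositionalEquality
open import Relation.Nullary using (Dec; yes; no; ¬_; ¬?; contradiction)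

private
  variable
    a b : Level
    A B : Set a

∑ : List A → (A → ℕ) → ℕ
∑ xs f = sum (map f xs)

syntax ∑ xs (λ x → e) = ∑[ x ∈ xs ] e

∑-cong : ∀ {f g : A → ℕ} xs → (∀ x → f x ≡ g x) → ∑ xs f ≡ ∑ xs g
∑-cong []       f≡g = refl
∑-cong (x ∷ xs) f≡g = cong₂ _+_ (f≡g x) (∑-cong xs f≡g)

∑-mono : ∀ {f g : A → ℕ} xs → (∀ x → f x ≤ g x) → ∑ xs f ≤ ∑ xs g
∑-mono []       f≤g = z≤n
∑-mono (x ∷ xs) f≤g = +-mono-≤ (f≤g x) (∑-mono xs f≤g)

∑-zero : (xs : List A) → ∑[ x ∈ xs ] 0 ≡ 0
∑-zero []       = refl
∑-zero (_ ∷ xs) = ∑-zero xs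

∑-+ : ∀ (f g : A → ℕ) xs → ∑[ x ∈ xs ] (f x + g x) ≡ ∑ xs f + ∑ xs g
∑-+ f g []       = refl
∑-+ f g (x ∷ xs) = begin
  f x + g x + ∑[ y ∈ xs ] (f y + g y) ≡⟨ cong (f x + g x +_) (∑-+ f g xs) ⟩
  f x + g x + (∑ xs f + ∑ xs g)       ≡⟨ interchange (f x) (g x) (∑ xs f) (∑ xs g) ⟩
  f x + ∑ xs f + (g x + ∑ xs g)       ∎
  where
  open ≡-Reasoning
  interchange : ∀ p q r s → p + q + (r + s) ≡ p + r + (q + s)
  interchange = ℕ-Solver.solve-∀

∑-map : ∀ (f : B → ℕ) (g : A → B) xs → ∑ (map g xs) f ≡ ∑[ x ∈ xs ] f (g x)
∑-map f g xs = cong sum (sym (map-∘ xs))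

∑-swap : ∀ (h : A → B → ℕ) xs ys →
  ∑[ x ∈ xs ] ∑[ y ∈ ys ] h x y ≡ ∑[ y ∈ ys ] ∑[ x ∈ xs ] h x y
∑-swap h []       ys = sym (∑-zero ys)
∑-swap h (x ∷ xs) ys = begin
  ∑[ y ∈ ys ] h x y + ∑[ x′ ∈ xs ] ∑[ y ∈ ys ] h x′ y
    ≡⟨ cong (∑[ y ∈ ys ] h x y +_) (∑-swap h xs ys) ⟩
  ∑[ y ∈ ys ] h x y + ∑[ y ∈ ys ] ∑[ x′ ∈ xs ] h x′ y
    ≡⟨ sym (∑-+ (h x) (λ y → ∑[ x′ ∈ xs ] h x′ y) ys) ⟩
  ∑[ y ∈ ys ] (h x y + ∑[ x′ ∈ xs ] h x′ y) ∎
  where open ≡-Reasoning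

𝟙 : {P : Set a} → Dec P → ℕ
𝟙 (yes _) = 1
𝟙 (no _)  = 0

𝟙-cong : {P : Set a} {Q : Set b} (p : Dec P) (q : Dec Q) → (P → Q) → (Q → P) → 𝟙 p ≡ 𝟙 q
𝟙-cong (yes _) (yes _) P→Q Q→P = refl
𝟙-cong (yes p) (no ¬q) P→Q Q→P = contradiction (P→Q p) ¬q
𝟙-cong (no ¬p) (yes q) P→Q Q→P = contradiction (Q→P q) ¬p
𝟙-cong (no _)  (no _)  P→Q Q→P = refl

1⊓-subadditive : ∀ p q → 1 ⊓ (p + q) ≤ 1 ⊓ p + q
1⊓-subadditive zero    q = m⊓n≤n 1 q
1⊓-subadditive (suc p) q = s≤s z≤n

1⊓-+-monoˡ : ∀ p q → 1 ⊓ q ≤ 1 ⊓ (p + q)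
1⊓-+-monoˡ p q = ⊓-monoʳ-≤ 1 (m≤n+m q p)

1⊓-+-monoʳ : ∀ p q → 1 ⊓ p ≤ 1 ⊓ (p + q)
1⊓-+-monoʳ p q = ⊓-monoʳ-≤ 1 (m≤m+n p q)

-- Multiplicities, repeats and their interaction with concatenation, for lists
-- over any type with decidable equality.  For ℤ (with ℤP._≟_), mult is
-- definitionally Defs.count.

module Multiplicity {A : Set a} (_≟_ : DecidableEquality A) where

  mult : A → List A → ℕ
  mult x xs = length (filter (_≟ x) xs)

  mult-as-∑ : ∀ x xs → mult x xs ≡ ∑[ y ∈ xs ] 𝟙 (y ≟ x)
  mult-as-∑ x []       = refl
  mult-as-∑ x (y ∷ ys) with y ≟ x
  ... | yes _ = cong suc (mult-as-∑ x ys)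
  ... | no  _ = mult-as-∑ x ys

  mult-map : ∀ x (g : B → A) ys → mult x (map g ys) ≡ ∑[ y ∈ ys ] 𝟙 (g y ≟ x)
  mult-map x g ys = trans (mult-as-∑ x (map g ys)) (∑-map (λ z → 𝟙 (z ≟ x)) g ys)

  mult-++ : ∀ x xs ys → mult x (xs ++ ys) ≡ mult x xs + mult x ys
  mult-++ x xs ys = trans (cong length (filter-++ (_≟ x) xs ys)) (length-++ (filter (_≟ x) xs))

  mult-here : ∀ x ys → mult x (x ∷ ys) ≡ suc (mult x ys)
  mult-here x ys = cong length (filter-accept (_≟ x) refl)

  mult-there : ∀ {x n} ys → ¬ x ≡ n → mult n (x ∷ ys) ≡ mult n ys
  mult-there ys x≢n = cong length (filter-reject (_≟ _) x≢n)

  mult-absent : ∀ {x} ys → All (λ y → ¬ x ≡ y) ys → mult x ys ≡ 0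
  mult-absent []       []           = refl
  mult-absent (y ∷ ys) (x≢y ∷ x∉ys) =
    trans (mult-there ys (x≢y ∘ sym)) (mult-absent ys x∉ys)

  mult-unique : ∀ x ys → Unique ys → mult x ys ≤ 1
  mult-unique x []       _ = z≤n
  mult-unique x (y ∷ ys) (y∉ys ∷ uys) with y ≟ x
  ... | yes refl = s≤s (≤-reflexive (mult-absent ys y∉ys))
  ... | no  _    = mult-unique x ys uys

  repeats : List A → ℕ
  repeats []       = 0
  repeats (x ∷ xs) = 1 ⊓ mult x xs + repeats xs

  repeats-unique : ∀ xs → Unique xs → repeats xs ≡ 0
  repeats-unique []       _              = refl
  repeats-unique (x ∷ xs) (x∉xs ∷ uxs) rewrite mult-absent xs x∉xs = repeats-unique xs uxs

  hits meets : List A → List A → ℕ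
  hits  L M = ∑[ x ∈ L ] mult x M
  meets L M = ∑[ x ∈ L ] (1 ⊓ mult x M)

  hits-++ : ∀ L M N → hits L (M ++ N) ≡ hits L M + hits L N
  hits-++ L M N = trans (∑-cong L (λ x → mult-++ x M N)) (∑-+ (λ x → mult x M) (λ x → mult x N) L)

  hits-unique : ∀ L M → Unique M → hits L M ≡ meets L M
  hits-unique L M uM = ∑-cong L (λ x → sym (m≥n⇒m⊓n≡n (mult-unique x M uM)))

  meets-++ˡ : ∀ L M N → meets L M ≤ meets L (M ++ N)
  meets-++ˡ L M N = ∑-mono L (λ x → ≤-trans (1⊓-+-monoʳ (mult x M) (mult x N))
                                             (≤-reflexive (cong (1 ⊓_) (sym (mult-++ x M N)))))

  meets-++ʳ : ∀ L M N → meets L N ≤ meets L (M ++ N)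
  meets-++ʳ L M N = ∑-mono L (λ x → ≤-trans (1⊓-+-monoˡ (mult x M) (mult x N))
                                             (≤-reflexive (cong (1 ⊓_) (sym (mult-++ x M N)))))

  -- Upper bound: a repeat in L ++ M lies in L and recurs in L or in M, or lies in M.
  repeats-++-≤ : ∀ L M → repeats (L ++ M) ≤ repeats L + hits L M + repeats M
  repeats-++-≤ []      M = ≤-refl
  repeats-++-≤ (x ∷ L) M = begin
    1 ⊓ mult x (L ++ M) + repeats (L ++ M)
      ≤⟨ +-mono-≤ (≤-reflexive (cong (1 ⊓_) (mult-++ x L M))) (repeats-++-≤ L M) ⟩
    1 ⊓ (mult x L + mult x M) + (repeats L + hits L M + repeats M)
      ≤⟨ +-monoˡ-≤ _ (1⊓-subadditive (mult x L) (mult x M)) ⟩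
    1 ⊓ mult x L + mult x M + (repeats L + hits L M + repeats M)
      ≡⟨ regroup (1 ⊓ mult x L) (mult x M) (repeats L) (hits L M) (repeats M) ⟩
    1 ⊓ mult x L + repeats L + (mult x M + hits L M) + repeats M ∎
    where
    open ≤-Reasoning
    regroup : ∀ p q r s t → p + q + (r + s + t) ≡ p + r + (q + s) + t
    regroup = ℕ-Solver.solve-∀

  -- Lower bound: every entry of L occurring in M is a repeat of L ++ M.
  repeats-++-≥ : ∀ L M → meets L M + repeats M ≤ repeats (L ++ M)
  repeats-++-≥ []      M = ≤-refl
  repeats-++-≥ (x ∷ L) M = begin
    1 ⊓ mult x M + meets L M + repeats M
      ≡⟨ +-assoc (1 ⊓ mult x M) (meets L M) (repeats M) ⟩
    1 ⊓ mult x M + (meets L M + repeats M)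
      ≤⟨ +-mono-≤ (1⊓-+-monoˡ (mult x L) (mult x M)) (repeats-++-≥ L M) ⟩
    1 ⊓ (mult x L + mult x M) + repeats (L ++ M)
      ≡⟨ cong (λ m → 1 ⊓ m + repeats (L ++ M)) (sym (mult-++ x L M)) ⟩
    1 ⊓ mult x (L ++ M) + repeats (L ++ M) ∎
    where open ≤-Reasoning

  -- Crossing pairs between two images: if g w = f v exactly when f′ v = g′ w,
  -- then hits (f V) (g W) = hits (g′ W) (f′ V) (both count the same pairs (v, w)).
  hits-map-transpose : ∀ (f g f′ g′ : B → A) V W →
    (∀ v w → g w ≡ f v → f′ v ≡ g′ w) → (∀ v w → f′ v ≡ g′ w → g w ≡ f v) →
    hits (map f V) (map g W) ≡ hits (map g′ W) (map f′ V)
  hits-map-transpose f g f′ g′ V W ⇒ ⇐ = begin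
    hits (map f V) (map g W)
      ≡⟨ ∑-map (λ x → mult x (map g W)) f V ⟩
    ∑[ v ∈ V ] mult (f v) (map g W)
      ≡⟨ ∑-cong V (λ v → trans (mult-map (f v) g W)
                       (∑-cong W (λ w → 𝟙-cong (g w ≟ f v) (f′ v ≟ g′ w) (⇒ v w) (⇐ v w)))) ⟩
    ∑[ v ∈ V ] ∑[ w ∈ W ] 𝟙 (f′ v ≟ g′ w)
      ≡⟨ ∑-swap (λ v w → 𝟙 (f′ v ≟ g′ w)) V W ⟩
    ∑[ w ∈ W ] ∑[ v ∈ V ] 𝟙 (f′ v ≟ g′ w)
      ≡⟨ ∑-cong W (λ w → sym (mult-map (g′ w) f′ V)) ⟩
    ∑[ w ∈ W ] mult (g′ w) (map f′ V)
      ≡⟨ sym (∑-map (λ x → mult x (map f′ V)) g′ W) ⟩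
    hits (map g′ W) (map f′ V) ∎
    where open ≡-Reasoning

  excess : List A → ℕ
  excess L = sum (map (λ n → mult n L ∸ 1) (filter (λ n → 1 <? mult n L) (deduplicate _≟_ L)))

  private
    without : A → List A → List A
    without x = filter (λ y → ¬? (x ≟ y))

    mult-without-same : ∀ x D → mult x (without x D) ≡ 0
    mult-without-same x []      = refl
    mult-without-same x (y ∷ D) with x ≟ y
    ... | yes _   = mult-without-same x D
    ... | no  x≢y = trans (mult-there (without x D) (x≢y ∘ sym)) (mult-without-same x D)

    mult-without-other : ∀ {x n} D → ¬ x ≡ n → mult n (without x D) ≡ mult n D
    mult-without-other             []      x≢n = refl
    mult-without-other {x} {n} (y ∷ D) x≢n with x ≟ y
    ... | yes refl = sym (trans (mult-there D x≢n) (sym (mult-without-other D x≢n)))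
    ... | no  _ with y ≟ n
    ...   | yes _ = cong suc (mult-without-other D x≢n)
    ...   | no  _ = mult-without-other D x≢n

    mult-dedup : ∀ x xs → mult x (deduplicate _≟_ xs) ≡ 1 ⊓ mult x xs
    mult-dedup x []       = refl
    mult-dedup x (y ∷ ys) with y ≟ x
    ... | yes refl = cong suc (mult-without-same y (deduplicate _≟_ ys))
    ... | no  y≢x  = trans (mult-without-other (deduplicate _≟_ ys) y≢x) (mult-dedup x ys)

    ∑-split : ∀ (h : A → ℕ) x D → ∑ D h ≡ mult x D * h x + ∑ (without x D) h
    ∑-split h x []      = refl
    ∑-split h x (y ∷ D) with x ≟ y | y ≟ x
    ... | yes refl | yes _   = trans (cong (h x +_) (∑-split h x D))
                                     (sym (+-assoc (h x) (mult x D * h x) _))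
    ... | yes x≡y  | no  y≢x = contradiction (sym x≡y) y≢x
    ... | no  x≢y  | yes y≡x = contradiction (sym y≡x) x≢y
    ... | no  _    | no  _   = trans (cong (h y +_) (∑-split h x D))
                                     (sym (+-assoc-comm (h y) (mult x D * h x) _))
      where
      +-assoc-comm : ∀ p q r → q + (p + r) ≡ p + (q + r)
      +-assoc-comm = ℕ-Solver.solve-∀

    ∑-without-cong : ∀ {f g : A → ℕ} x D → (∀ n → ¬ x ≡ n → f n ≡ g n) →
      ∑ (without x D) f ≡ ∑ (without x D) g
    ∑-without-cong x []      f≡g = refl
    ∑-without-cong x (y ∷ D) f≡g with x ≟ y
    ... | yes _   = ∑-without-cong x D f≡g
    ... | no  x≢y = cong₂ _+_ (f≡g y x≢y) (∑-without-cong x D f≡g)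

    -- Terms with multiplicity ≤ 1 contribute 0, so the filter can be dropped.
    ∑-drop-filter : ∀ (f : A → ℕ) xs →
      ∑ (filter (λ n → 1 <? f n) xs) (λ n → f n ∸ 1) ≡ ∑[ n ∈ xs ] (f n ∸ 1)
    ∑-drop-filter f []       = refl
    ∑-drop-filter f (x ∷ xs) with 1 <? f x
    ... | yes f>1 rewrite filter-accept (λ n → 1 <? f n) {x} {xs} f>1 =
      cong (f x ∸ 1 +_) (∑-drop-filter f xs)
    ... | no  f≯1 rewrite filter-reject (λ n → 1 <? f n) {x} {xs} f≯1 =
      trans (∑-drop-filter f xs) (cong (_+ ∑[ n ∈ xs ] (f n ∸ 1)) (sym (m≤n⇒m∸n≡0 (≮⇒≥ f≯1))))

    -- Σ over the distinct values n of xs of (mult n xs - 1), by induction on xs: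
    -- the head x contributes 1 ⊓ mult x ys, all other values are unaffected.
    ∑-dedup-excess : ∀ xs → ∑[ n ∈ deduplicate _≟_ xs ] (mult n xs ∸ 1) ≡ repeats xs
    ∑-dedup-excess []       = refl
    ∑-dedup-excess (x ∷ ys) = begin
      (mult x (x ∷ ys) ∸ 1) + ∑[ n ∈ without x D ] (mult n (x ∷ ys) ∸ 1)
        ≡⟨ cong₂ _+_ (cong (_∸ 1) (mult-here x ys))
                     (∑-without-cong x D (λ n x≢n → cong (_∸ 1) (mult-there ys x≢n))) ⟩
      c + ∑ (without x D) h
        ≡⟨ count-x (mult-dedup x ys) ⟩
      1 ⊓ c + (mult x D * h x + ∑ (without x D) h)
        ≡⟨ cong (1 ⊓ c +_) (sym (∑-split h x D)) ⟩
      1 ⊓ c + ∑ D h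
        ≡⟨ cong (1 ⊓ c +_) (∑-dedup-excess ys) ⟩
      1 ⊓ c + repeats ys ∎
      where
      open ≡-Reasoning
      D = deduplicate _≟_ ys
      h = λ n → mult n ys ∸ 1
      c = mult x ys
      -- c = 1 ⊓ c + [x ∈ D] · (c - 1), as x ∈ D exactly when c > 0.
      count-x : ∀ {k r} → mult x D ≡ 1 ⊓ k → k + r ≡ 1 ⊓ k + (mult x D * (k ∸ 1) + r)
      count-x {zero}  x∉D rewrite x∉D = refl
      count-x {suc k} x∈D rewrite x∈D | +-identityʳ k = refl

  excess≡repeats : ∀ L → excess L ≡ repeats L
  excess≡repeats L = trans (∑-drop-filter (λ n → mult n L) (deduplicate _≟_ L)) (∑-dedup-excess L)

open Multiplicity ℤP._≟_

injective-by : ∀ (f g : ℤ → ℤ) → (∀ z → g (f z) ≡ z) → ∀ {x y} → f x ≡ f y → x ≡ y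
injective-by f g g∘f≡id {x} {y} fx≡fy = trans (sym (g∘f≡id x)) (trans (cong g fx≡fy) (g∘f≡id y))

translate-injective : ∀ u {x y} → u ℤ.+ x ≡ u ℤ.+ y → x ≡ y
translate-injective u = injective-by (λ z → u ℤ.+ z) (λ z → ℤ.- u ℤ.+ z) (cancel u)
  where
  cancel : ∀ u z → ℤ.- u ℤ.+ (u ℤ.+ z) ≡ z
  cancel = ℤ-Solver.solve-∀

subtract-injective : ∀ u {x y} → x ℤ.- u ≡ y ℤ.- u → x ≡ y
subtract-injective u = injective-by (ℤ._- u) (ℤ._+ u) (cancel u)
  where
  cancel : ∀ u z → z ℤ.- u ℤ.+ u ≡ z
  cancel = ℤ-Solver.solve-∀

diff⇒sum : ∀ u u′ v w → w ℤ.- u′ ≡ v ℤ.- u → u′ ℤ.+ v ≡ u ℤ.+ w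
diff⇒sum u u′ v w e = begin
  u′ ℤ.+ v                   ≡⟨ move-in u u′ v ⟩
  (v ℤ.- u) ℤ.+ (u ℤ.+ u′)   ≡⟨ cong (ℤ._+ (u ℤ.+ u′)) (sym e) ⟩
  (w ℤ.- u′) ℤ.+ (u ℤ.+ u′)  ≡⟨ move-out u u′ w ⟩
  u ℤ.+ w                    ∎
  where
  open ≡-Reasoning
  move-in : ∀ u u′ v → u′ ℤ.+ v ≡ (v ℤ.- u) ℤ.+ (u ℤ.+ u′)
  move-in = ℤ-Solver.solve-∀
  move-out : ∀ u u′ w → (w ℤ.- u′) ℤ.+ (u ℤ.+ u′) ≡ u ℤ.+ w
  move-out = ℤ-Solver.solve-∀

sum⇒diff : ∀ u u′ v w → u′ ℤ.+ v ≡ u ℤ.+ w → w ℤ.- u′ ≡ v ℤ.- u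
sum⇒diff u u′ v w e = begin
  w ℤ.- u′                   ≡⟨ move-in u u′ w ⟩
  (u ℤ.+ w) ℤ.- (u ℤ.+ u′)   ≡⟨ cong (ℤ._- (u ℤ.+ u′)) (sym e) ⟩
  (u′ ℤ.+ v) ℤ.- (u ℤ.+ u′)  ≡⟨ move-out u u′ v ⟩
  v ℤ.- u                    ∎
  where
  open ≡-Reasoning
  move-in : ∀ u u′ w → w ℤ.- u′ ≡ (u ℤ.+ w) ℤ.- (u ℤ.+ u′)
  move-in = ℤ-Solver.solve-∀
  move-out : ∀ u u′ v → (u′ ℤ.+ v) ℤ.- (u ℤ.+ u′) ≡ v ℤ.- u
  move-out = ℤ-Solver.solve-∀

_⊕_ : ℤ → List ℤ → List ℤ
u ⊕ V = map (λ v → u ℤ.+ v) V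

_⊖_ : List ℤ → ℤ → List ℤ
V ⊖ u = map (λ v → v ℤ.- u) V

hits-translates : ∀ u u′ V → Unique V →
  hits (V ⊖ u) (V ⊖ u′) ≡ meets (u ⊕ V) (u′ ⊕ V)
hits-translates u u′ V uV = begin
  hits (V ⊖ u) (V ⊖ u′)
    ≡⟨ hits-map-transpose (ℤ._- u) (ℤ._- u′) (λ v → u′ ℤ.+ v) (λ w → u ℤ.+ w) V V
         (diff⇒sum u u′) (sum⇒diff u u′) ⟩
  hits (u ⊕ V) (u′ ⊕ V)
    ≡⟨ hits-unique (u ⊕ V) (u′ ⊕ V)
         (Unique.map⁺ (translate-injective u′) uV) ⟩
  meets (u ⊕ V) (u′ ⊕ V) ∎
  where open ≡-Reasoning

hits-diffs : ∀ u V → Unique V → ∀ U →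
  hits (V ⊖ u) (diffs U V) ≤ length U * meets (u ⊕ V) (sums U V)
hits-diffs u V uV []       = ≤-reflexive (∑-zero (V ⊖ u))
hits-diffs u V uV (u′ ∷ U) = begin
  hits L (V ⊖ u′ ++ diffs U V)
    ≡⟨ hits-++ L (V ⊖ u′) (diffs U V) ⟩
  hits L (V ⊖ u′) + hits L (diffs U V)
    ≤⟨ +-mono-≤ (≤-reflexive (hits-translates u u′ V uV)) (hits-diffs u V uV U) ⟩
  meets M (u′ ⊕ V) + length U * meets M (sums U V)
    ≤⟨ +-mono-≤ (meets-++ˡ M (u′ ⊕ V) (sums U V))
                (*-monoʳ-≤ (length U) (meets-++ʳ M (u′ ⊕ V) (sums U V))) ⟩
  meets M (sums (u′ ∷ U) V) + length U * meets M (sums (u′ ∷ U) V) ∎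
  where
  open ≤-Reasoning
  L = V ⊖ u
  M = u ⊕ V

repeats-diffs≤ : ∀ V → Unique V → ∀ U → repeats (diffs U V) ≤ length U * repeats (sums U V)
repeats-diffs≤ V uV []      = z≤n
repeats-diffs≤ V uV (u ∷ U) = begin
  repeats (L ++ diffs U V)
    ≤⟨ repeats-++-≤ L (diffs U V) ⟩
  repeats L + hits L (diffs U V) + repeats (diffs U V)
    ≡⟨ cong (λ r → r + hits L (diffs U V) + repeats (diffs U V))
            (repeats-unique L (Unique.map⁺ (subtract-injective u) uV)) ⟩
  hits L (diffs U V) + repeats (diffs U V)
    ≤⟨ +-mono-≤ (hits-diffs u V uV U) (repeats-diffs≤ V uV U) ⟩
  length U * meets M (sums U V) + length U * repeats (sums U V)
    ≡⟨ sym (*-distribˡ-+ (length U) (meets M (sums U V)) _) ⟩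
  length U * (meets M (sums U V) + repeats (sums U V))
    ≤⟨ *-monoʳ-≤ (length U) (repeats-++-≥ M (sums U V)) ⟩
  length U * repeats (M ++ sums U V)
    ≤⟨ m≤n+m _ (repeats (M ++ sums U V)) ⟩
  suc (length U) * repeats (M ++ sums U V) ∎
  where
  open ≤-Reasoning
  L = V ⊖ u
  M = u ⊕ V

lemma1 : (u₀ : ℤ) (U' V : List ℤ) → Unique (u₀ ∷ U') → Unique V →
    excessSum (diffs (u₀ ∷ U') V) (δ (u₀ ∷ U') V)
      ≤ length (u₀ ∷ U') * excessSum (sums (u₀ ∷ U') V) (σ (u₀ ∷ U') V)
lemma1 u₀ U' V _ uV = begin
  excess (diffs U V)           ≡⟨ excess≡repeats (diffs U V) ⟩
  repeats (diffs U V)          ≤⟨ repeats-diffs≤ V uV U ⟩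
  length U * repeats (sums U V) ≡⟨ cong (length U *_) (sym (excess≡repeats (sums U V))) ⟩
  length U * excess (sums U V) ∎
  where
  open ≤-Reasoning
  U = u₀ ∷ U'
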